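{- For every prime power $q$, field $F$, integers $r,k\ge0$, tuple $\mathcal{L}=(L_1,\dots,L_s)$ of pairwise disjoint finite subsets of $F\setminus\{0\}$, and $\kappa\in\mathbb{Z}_{\ge0}^s$: \[ \overline{\mathrm{ex}}_q(r,k)\le\sum_{i=0}^k\binom{r}{i}(q-1)^{r-i},\qquad \mathrm{ex}_{F,\mathcal{L}}(r,\kappa)\le\sum_{\kappa'\preceq\kappa}\binom{r}{\kappa'}\mathcal{L}^{\kappa'},\qquad \mathrm{ex}_q(r,k)\le\sum_{i=0}^k\binom{r}{i}(q-1)^i. \]
   Context: $F_q$ is the finite field with $q$ elements; the weight of a vector is its number of nonzero entries. $\mathrm{ex}_q(r,k)$ (resp. $\overline{\mathrm{ex}}_q(r,k)$) is the maximum number of distinct columns of a matrix over $F_q$ (any number of rows) of rank at most $r$ all of whose columns have weight exactly $k$ (resp. exactly $k$ zero entries). A vector over $F$ is an $(\mathcal{L},\kappa)$-vector, $\kappa=(k_1,\dots,k_s)$, if for each $i$ exactly $k_i$ of its entries lie in $L_i$ and all other entries are $0$; $\mathrm{ex}_{F,\mathcal{L}}(r,\kappa)$ is the maximum number of distinct columns of a matrix over $F$ of rank at most $r$ all of whose columns are $(\mathcal{L},\kappa)$-vectors. $\kappa'\preceq\kappa$ means $k'_i\le k_i$ for all $i$ (with $\kappa'\in\mathbb{Z}_{\ge0}^s$). $\binom{r}{\kappa'}=\frac{r!}{k'_1!\cdots k'_s!(r-\sum_i k'_i)!}$ (zero if $\sum_i k'_i>r$) and $\mathcal{L}^{\kappa'}=\prod_i|L_i|^{k'_i}$.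 -}

module Defs where

open import Level using (Level; _⊔_; suc)
open import Algebra.Bundles using (CommutativeRing)
open import Data.Nat as ℕ using (ℕ; zero; NonZero; _≤_; _!; _^_; _∸_)
  renaming (suc to 1+; _+_ to _+ℕ_; _*_ to _*ℕ_)
open import Data.Nat.Properties using (_!≢0; m*n≢0)
open import Data.Nat.Combinatorics using (_C_)
open import Data.Fin using (Fin) renaming (zero to fzero; suc to fsuc)
open import Data.Fin.Subset using (Subset; _∈_; _∉_; ∣_∣)
open import Data.Product using (Σ; ∃; _×_)
open import Relation.Binary.PropositionalEquality using (_≡_)
open import Relation.Nullary using (¬_)
open import Data.Bool using (if_then_else_)

record Field (c ℓ : Level) : Set (suc (c ⊔ ℓ)) where
  field
    commutativeRing : CommutativeRing c ℓ
  open CommutativeRing commutativeRing public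
  field
    0≉1     : ¬ (0# ≈ 1#)
    inverse : ∀ x → ¬ (x ≈ 0#) → Σ Carrier (λ y → x * y ≈ 1#)

sumTo : ℕ → (ℕ → ℕ) → ℕ
sumTo zero     f = f 0
sumTo (1+ k)   f = sumTo k f +ℕ f (1+ k)

sumFin : ∀ {s} → (Fin s → ℕ) → ℕ
sumFin {zero}   f = 0
sumFin {1+ s}   f = f fzero +ℕ sumFin (λ i → f (fsuc i))

prodFin : ∀ {s} → (Fin s → ℕ) → ℕ
prodFin {zero}  f = 1
prodFin {1+ s}  f = f fzero *ℕ prodFin (λ i → f (fsuc i))

cons : ∀ {s} → ℕ → (Fin s → ℕ) → (Fin (1+ s) → ℕ)
cons x κ fzero    = x
cons x κ (fsuc i) = κ i

-- ∑_{κ' ⪯ κ} g κ'   (sum over all κ' ∈ ℤ≥0^s with κ' i ≤ κ i for all i)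
sumBelow : ∀ {s} → (Fin s → ℕ) → ((Fin s → ℕ) → ℕ) → ℕ
sumBelow {zero}  κ g = g (λ ())
sumBelow {1+ s}  κ g =
  sumTo (κ fzero) (λ j → sumBelow (λ i → κ (fsuc i)) (λ κ'' → g (cons j κ'')))

prodFact-nonZero : ∀ {s} (κ : Fin s → ℕ) → NonZero (prodFin (λ i → κ i !))
prodFact-nonZero {zero}  κ = _
prodFact-nonZero {1+ s}  κ =
  m*n≢0 (κ fzero !) (prodFin (λ i → κ (fsuc i) !))
    {{κ fzero !≢0}} {{prodFact-nonZero (λ i → κ (fsuc i))}}

-- multinomial coefficient  r! / (k'₁! ⋯ k'ₛ! (r - ∑ k'ᵢ)!), zero if ∑ k'ᵢ > r
multinom : ∀ {s} → ℕ → (Fin s → ℕ) → ℕ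
multinom r κ' =
  if sumFin κ' ℕ.≤ᵇ r
  then ℕ._/_ (r !) (prodFin (λ i → κ' i !) *ℕ ((r ∸ sumFin κ') !))
         {{m*n≢0 _ _ {{prodFact-nonZero κ'}} {{(r ∸ sumFin κ') !≢0}}}}
  else 0

module _ {c ℓ : Level} (F : Field c ℓ) where
  open Field F

  ∑ : ∀ {n} → (Fin n → Carrier) → Carrier
  ∑ {zero}  f = 0#
  ∑ {1+ n}  f = f fzero + ∑ (λ i → f (fsuc i))

  -- an m × n matrix (m rows, n columns): M i a is the entry in row i, column a
  Matrix : ℕ → ℕ → Set c
  Matrix m n = Fin m → Fin n → Carrier

  column : ∀ {m n} → Matrix m n → Fin n → (Fin m → Carrier)
  column M a i = M i a

  -- rank ≤ r : the column space is contained in the span of r vectors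
  -- b₀,…,b_{r-1} ∈ F^m, i.e. every column is a linear combination of them.
  RankAtMost : ∀ {m n} → ℕ → Matrix m n → Set (c ⊔ ℓ)
  RankAtMost {m} {n} r M =
    Σ (Fin r → Fin m → Carrier) λ b →
    Σ (Fin n → Fin r → Carrier) λ coeff →
      ∀ i a → M i a ≈ ∑ (λ j → coeff a j * b j i)

  DistinctColumns : ∀ {m n} → Matrix m n → Set ℓ
  DistinctColumns {m} {n} M =
    ∀ (a b : Fin n) → ¬ (a ≡ b) → ¬ (∀ i → M i a ≈ M i b)

  HasWeight : ∀ {m} → ℕ → (Fin m → Carrier) → Set ℓ
  HasWeight {m} k v =
    Σ (Subset m) λ S → ∣ S ∣ ≡ k ×
      (∀ p → p ∈ S → ¬ (v p ≈ 0#)) × (∀ p → p ∉ S → v p ≈ 0#)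

  HasZeros : ∀ {m} → ℕ → (Fin m → Carrier) → Set ℓ
  HasZeros {m} k v =
    Σ (Subset m) λ S → ∣ S ∣ ≡ k ×
      (∀ p → p ∈ S → v p ≈ 0#) × (∀ p → p ∉ S → ¬ (v p ≈ 0#))

  HasCardinality : ℕ → Set (c ⊔ ℓ)
  HasCardinality q =
    Σ (Fin q → Carrier) λ e →
      (∀ i j → e i ≈ e j → i ≡ j) × (∀ x → Σ (Fin q) λ i → x ≈ e i)

  record FinSubsetNZ : Set (c ⊔ ℓ) where
    field
      size      : ℕ
      elem      : Fin size → Carrier
      elem-inj  : ∀ i j → elem i ≈ elem j → i ≡ j
      elem-nz   : ∀ i → ¬ (elem i ≈ 0#)

  open FinSubsetNZ public

  _∈L_ : Carrier → FinSubsetNZ → Set ℓ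
  x ∈L L = Σ (Fin (size L)) λ j → x ≈ elem L j

  PairwiseDisjoint : ∀ {s} → (Fin s → FinSubsetNZ) → Set (c ⊔ ℓ)
  PairwiseDisjoint {s} L =
    ∀ (i i' : Fin s) → ¬ (i ≡ i') → ∀ x → x ∈L L i → ¬ (x ∈L L i')

  IsLκVector : ∀ {m s} → (Fin s → FinSubsetNZ) → (Fin s → ℕ) →
               (Fin m → Carrier) → Set ℓ
  IsLκVector {m} {s} L κ v =
    Σ (Fin s → Subset m) λ S →
      (∀ i → ∣ S i ∣ ≡ κ i) ×
      (∀ i p → p ∈ S i → v p ∈L L i) ×
      (∀ i p → v p ∈L L i → p ∈ S i) ×
      (∀ p → (∀ i → p ∉ S i) → v p ≈ 0#)

  Lpow : ∀ {s} → (Fin s → FinSubsetNZ) → (Fin s → ℕ) → ℕ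
  Lpow L κ' = prodFin (λ i → size (L i) ^ κ' i)

module Submission where

-- Let the columns of M be combinations of b₁, …, b_r.  Gaussian elimination
-- gives an information set I of at most r coordinates: a combination of the bᵢ that
-- vanishes on I vanishes everywhere.  Hence distinct columns stay distinct after
-- restriction to I.  Encode every entry by a letter of an alphabet with a free class
-- of u letters and classes of l₁, …, lₛ letters (0 / nonzero, or the sets Lᵢ).  The
-- restricted columns become distinct words of length ≤ r whose class profile is ⪯ κ,
-- and the words with profile κ' number multinom(r, κ') ∏ lᵢ^κ'ᵢ u^(r - |κ'|).

open import Defs

module FiniteSums where

  open import Function using (_∘_)
  open import Data.Nat using (ℕ; zero; suc; _+_; _*_; _≤_; z≤n; s≤s)
  open import Data.Nat.Properties
  open import Data.Fin using (Fin) renaming (zero to fzero; suc to fsuc)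
  open import Data.Fin.Properties using () renaming (suc-injective to fsuc-injective)
  open import Data.Bool using (true; false; if_then_else_)
  open import Data.List using (List; []; _∷_; length; filter; map)
  open import Data.List.Relation.Unary.All as All using (All; []; _∷_)
  import Data.List.Relation.Unary.All.Properties as All
  open import Data.List.Relation.Unary.AllPairs using (AllPairs; []; _∷_)
  open import Data.Product using (_,_)
  open import Data.Vec.Functional.Properties using (≗-dec)
  open import Relation.Nullary using (¬_; Dec; does; yes; no)
  open import Relation.Nullary.Decidable using (dec-true; dec-false)
  open import Relation.Binary.PropositionalEquality
  open import Algebra.Properties.CommutativeSemigroup +-commutativeSemigroup
    using () renaming (interchange to +-interchange; x∙yz≈y∙xz to x+[y+z]≡y+[x+z])
  open import Algebra.Properties.CommutativeSemigroup *-commutativeSemigroup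
    using () renaming (x∙yz≈y∙xz to x*[y*z]≡y*[x*z])

  𝟙 : ∀ {p} {P : Set p} → Dec P → ℕ
  𝟙 P? = if does P? then 1 else 0

  𝟙-yes : ∀ {p} {P : Set p} (P? : Dec P) → P → 𝟙 P? ≡ 1
  𝟙-yes P? p rewrite dec-true P? p = refl

  𝟙-no : ∀ {p} {P : Set p} (P? : Dec P) → ¬ P → 𝟙 P? ≡ 0
  𝟙-no P? ¬p rewrite dec-false P? ¬p = refl

  sumFin-cong : ∀ {s} {f g : Fin s → ℕ} → (∀ i → f i ≡ g i) → sumFin f ≡ sumFin g
  sumFin-cong {zero}  f≗g = refl
  sumFin-cong {suc s} f≗g = cong₂ _+_ (f≗g fzero) (sumFin-cong (f≗g ∘ fsuc))

  prodFin-cong : ∀ {s} {f g : Fin s → ℕ} → (∀ i → f i ≡ g i) → prodFin f ≡ prodFin g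
  prodFin-cong {zero}  f≗g = refl
  prodFin-cong {suc s} f≗g = cong₂ _*_ (f≗g fzero) (prodFin-cong (f≗g ∘ fsuc))

  sumFin-+ : ∀ {s} (f g : Fin s → ℕ) → sumFin (λ i → f i + g i) ≡ sumFin f + sumFin g
  sumFin-+ {zero}  f g = refl
  sumFin-+ {suc s} f g =
    trans (cong (f fzero + g fzero +_) (sumFin-+ (f ∘ fsuc) (g ∘ fsuc)))
          (+-interchange (f fzero) (g fzero) _ _)

  sumFin-*ʳ : ∀ {s} (f : Fin s → ℕ) c → sumFin (λ i → f i * c) ≡ sumFin f * c
  sumFin-*ʳ {zero}  f c = refl
  sumFin-*ʳ {suc s} f c =
    trans (cong (f fzero * c +_) (sumFin-*ʳ (f ∘ fsuc) c)) (sym (*-distribʳ-+ c (f fzero) _))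

  sumFin-const : ∀ {s} c → sumFin {s} (λ _ → c) ≡ s * c
  sumFin-const {zero}  c = refl
  sumFin-const {suc s} c = cong (c +_) (sumFin-const {s} c)

  sumFin-zero : ∀ {s} → sumFin {s} (λ _ → 0) ≡ 0
  sumFin-zero {s} = trans (sumFin-const {s} 0) (*-zeroʳ s)

  prodFin-one : ∀ {s} → prodFin {s} (λ _ → 1) ≡ 1
  prodFin-one {zero}  = refl
  prodFin-one {suc s} = trans (+-identityʳ _) (prodFin-one {s})

  sumFin-mono : ∀ {s} {f g : Fin s → ℕ} → (∀ i → f i ≤ g i) → sumFin f ≤ sumFin g
  sumFin-mono {zero}  f≤g = z≤n
  sumFin-mono {suc s} f≤g = +-mono-≤ (f≤g fzero) (sumFin-mono (f≤g ∘ fsuc))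

  sumFin-zero⁻¹ : ∀ {s} (f : Fin s → ℕ) → sumFin f ≡ 0 → ∀ i → f i ≡ 0
  sumFin-zero⁻¹ {suc s} f ∑≡0 fzero    = m+n≡0⇒m≡0 (f fzero) ∑≡0
  sumFin-zero⁻¹ {suc s} f ∑≡0 (fsuc i) = sumFin-zero⁻¹ (f ∘ fsuc) (m+n≡0⇒n≡0 (f fzero) ∑≡0) i

  sumFin-single : ∀ {s} (f : Fin s → ℕ) i → (∀ j → j ≢ i → f j ≡ 0) → sumFin f ≡ f i
  sumFin-single {suc s} f fzero vanish =
    trans (cong (f fzero +_) (trans (sumFin-cong (λ j → vanish (fsuc j) λ ())) (sumFin-zero {s})))
          (+-identityʳ _)
  sumFin-single {suc s} f (fsuc i) vanish =
    trans (cong (_+ sumFin (f ∘ fsuc)) (vanish fzero λ ()))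
          (sumFin-single (f ∘ fsuc) i (λ j j≢i → vanish (fsuc j) (j≢i ∘ fsuc-injective)))

  sumFin-update : ∀ {s} (f g : Fin s → ℕ) i a → (∀ j → j ≢ i → f j ≡ g j) →
                  f i ≡ a + g i → sumFin f ≡ a + sumFin g
  sumFin-update {suc s} f g fzero a same fᵢ
    rewrite fᵢ | sumFin-cong {f = f ∘ fsuc} {g ∘ fsuc} (λ j → same (fsuc j) λ ()) =
    +-assoc a (g fzero) _
  sumFin-update {suc s} f g (fsuc i) a same fᵢ
    rewrite same fzero (λ ())
          | sumFin-update (f ∘ fsuc) (g ∘ fsuc) i a (λ j j≢i → same (fsuc j) (j≢i ∘ fsuc-injective)) fᵢ =
    x+[y+z]≡y+[x+z] (g fzero) a _

  prodFin-update : ∀ {s} (f g : Fin s → ℕ) i a → (∀ j → j ≢ i → f j ≡ g j) →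
                   f i ≡ a * g i → prodFin f ≡ a * prodFin g
  prodFin-update {suc s} f g fzero a same fᵢ
    rewrite fᵢ | prodFin-cong {f = f ∘ fsuc} {g ∘ fsuc} (λ j → same (fsuc j) λ ()) =
    *-assoc a (g fzero) _
  prodFin-update {suc s} f g (fsuc i) a same fᵢ
    rewrite same fzero (λ ())
          | prodFin-update (f ∘ fsuc) (g ∘ fsuc) i a (λ j j≢i → same (fsuc j) (j≢i ∘ fsuc-injective)) fᵢ =
    x*[y*z]≡y*[x*z] (g fzero) a _

  sumTo-cong : ∀ k {f g : ℕ → ℕ} → (∀ j → f j ≡ g j) → sumTo k f ≡ sumTo k g
  sumTo-cong zero    f≗g = f≗g 0
  sumTo-cong (suc k) f≗g = cong₂ _+_ (sumTo-cong k f≗g) (f≗g (suc k))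

  sumTo-mono : ∀ k {f g : ℕ → ℕ} → (∀ j → f j ≤ g j) → sumTo k f ≤ sumTo k g
  sumTo-mono zero    f≤g = f≤g 0
  sumTo-mono (suc k) f≤g = +-mono-≤ (sumTo-mono k f≤g) (f≤g (suc k))

  sumTo-+ : ∀ k (f g : ℕ → ℕ) → sumTo k (λ j → f j + g j) ≡ sumTo k f + sumTo k g
  sumTo-+ zero    f g = refl
  sumTo-+ (suc k) f g =
    trans (cong (_+ (f (suc k) + g (suc k))) (sumTo-+ k f g)) (+-interchange (sumTo k f) _ _ _)

  sumTo-vanish : ∀ k (f : ℕ → ℕ) → (∀ j → j ≤ k → f j ≡ 0) → sumTo k f ≡ 0
  sumTo-vanish zero    f vanish = vanish 0 z≤n
  sumTo-vanish (suc k) f vanish =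
    cong₂ _+_ (sumTo-vanish k f (λ j j≤k → vanish j (m≤n⇒m≤1+n j≤k))) (vanish (suc k) ≤-refl)

  sumTo-single : ∀ k (f : ℕ → ℕ) a → a ≤ k → (∀ j → j ≢ a → f j ≡ 0) → sumTo k f ≡ f a
  sumTo-single zero    f .0 z≤n vanish = refl
  sumTo-single (suc k) f a a≤1+k vanish with a ≟ suc k
  ... | yes refl = cong (_+ f (suc k)) (sumTo-vanish k f (λ j j≤k → vanish j (<⇒≢ (s≤s j≤k))))
  ... | no a≢1+k = trans (cong₂ _+_ (sumTo-single k f a a≤k vanish) (vanish (suc k) (a≢1+k ∘ sym)))
                         (+-identityʳ (f a))
    where a≤k = ≤-pred (≤∧≢⇒< a≤1+k a≢1+k)

  _⪯_ : ∀ {s} → (Fin s → ℕ) → (Fin s → ℕ) → Set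
  κ' ⪯ κ = ∀ i → κ' i ≤ κ i

  sumBelow-cong : ∀ {s} (κ : Fin s → ℕ) {g h : (Fin s → ℕ) → ℕ} → (∀ κ' → g κ' ≡ h κ') →
                  sumBelow κ g ≡ sumBelow κ h
  sumBelow-cong {zero}  κ g≗h = g≗h _
  sumBelow-cong {suc s} κ g≗h = sumTo-cong (κ fzero) (λ j → sumBelow-cong (κ ∘ fsuc) (g≗h ∘ cons j))

  sumBelow-mono : ∀ {s} (κ : Fin s → ℕ) {g h : (Fin s → ℕ) → ℕ} → (∀ κ' → g κ' ≤ h κ') →
                  sumBelow κ g ≤ sumBelow κ h
  sumBelow-mono {zero}  κ g≤h = g≤h _
  sumBelow-mono {suc s} κ g≤h = sumTo-mono (κ fzero) (λ j → sumBelow-mono (κ ∘ fsuc) (g≤h ∘ cons j))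

  sumBelow-+ : ∀ {s} (κ : Fin s → ℕ) (g h : (Fin s → ℕ) → ℕ) →
               sumBelow κ (λ κ' → g κ' + h κ') ≡ sumBelow κ g + sumBelow κ h
  sumBelow-+ {zero}  κ g h = refl
  sumBelow-+ {suc s} κ g h =
    trans (sumTo-cong (κ fzero) (λ j → sumBelow-+ (κ ∘ fsuc) (g ∘ cons j) (h ∘ cons j)))
          (sumTo-+ (κ fzero) _ _)

  sumBelow-vanish : ∀ {s} (κ : Fin s → ℕ) (g : (Fin s → ℕ) → ℕ) → (∀ κ' → g κ' ≡ 0) → sumBelow κ g ≡ 0
  sumBelow-vanish {zero}  κ g vanish = vanish _
  sumBelow-vanish {suc s} κ g vanish =
    sumTo-vanish (κ fzero) _ (λ j _ → sumBelow-vanish (κ ∘ fsuc) (g ∘ cons j) (vanish ∘ cons j))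

  sumBelow-single : ∀ {s} (κ : Fin s → ℕ) (g : (Fin s → ℕ) → ℕ) (h : Fin s → ℕ) → h ⪯ κ →
                    (∀ κ' → ¬ (h ≗ κ') → g κ' ≡ 0) → (∀ κ' → h ≗ κ' → g κ' ≡ g h) →
                    sumBelow κ g ≡ g h
  sumBelow-single {zero}  κ g h h⪯κ vanish invariant = invariant _ λ ()
  sumBelow-single {suc s} κ g h h⪯κ vanish invariant = begin
    sumTo (κ fzero) (λ j → sumBelow (κ ∘ fsuc) (g ∘ cons j))
      ≡⟨ sumTo-single (κ fzero) _ (h fzero) (h⪯κ fzero) (λ j j≢h₀ →
           sumBelow-vanish (κ ∘ fsuc) (g ∘ cons j) (λ κ'' → vanish (cons j κ'') (λ h≗ → j≢h₀ (sym (h≗ fzero))))) ⟩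
    sumBelow (κ ∘ fsuc) (g ∘ cons (h fzero))
      ≡⟨ sumBelow-single (κ ∘ fsuc) (g ∘ cons (h fzero)) (h ∘ fsuc) (h⪯κ ∘ fsuc)
           (λ κ'' h₊≉κ'' → vanish (cons (h fzero) κ'') (λ h≗ → h₊≉κ'' (h≗ ∘ fsuc)))
           (λ κ'' h₊≗κ'' → trans (invariant _ (head∷ h₊≗κ'')) (sym (invariant _ (head∷ λ _ → refl)))) ⟩
    g (cons (h fzero) (h ∘ fsuc))
      ≡⟨ invariant _ (head∷ λ _ → refl) ⟩
    g h ∎
    where
    open ≡-Reasoning
    head∷ : ∀ {κ''} → h ∘ fsuc ≗ κ'' → h ≗ cons (h fzero) κ''
    head∷ h₊≗κ'' fzero    = refl
    head∷ h₊≗κ'' (fsuc i) = h₊≗κ'' i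

  record Summation (K : Set) : Set where
    field
      sum      : (K → ℕ) → ℕ
      sum-cong : ∀ {f g} → (∀ k → f k ≡ g k) → sum f ≡ sum g
      sum-+    : ∀ f g → sum (λ k → f k + g k) ≡ sum f + sum g
      sum-zero : sum (λ _ → 0) ≡ 0

  length-filter-∷ : ∀ {X : Set} {P : X → Set} (P? : ∀ x → Dec (P x)) x xs →
                    length (filter P? (x ∷ xs)) ≡ 𝟙 (P? x) + length (filter P? xs)
  length-filter-∷ P? x xs with does (P? x)
  ... | true  = refl
  ... | false = refl

  module _ {X K : Set} (S : Summation K) (R : X → K → Set) (R? : ∀ x k → Dec (R x k)) where
    open Summation S

    length-partition : (xs : List X) → All (λ x → sum (λ k → 𝟙 (R? x k)) ≡ 1) xs →
                       length xs ≡ sum (λ k → length (filter (λ x → R? x k) xs))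
    length-partition []       []              = sym sum-zero
    length-partition (x ∷ xs) (once ∷ onces) = begin
      1 + length xs
        ≡⟨ cong₂ _+_ (sym once) (length-partition xs onces) ⟩
      sum (λ k → 𝟙 (R? x k)) + sum (λ k → length (filter (λ y → R? y k) xs))
        ≡⟨ sum-+ _ _ ⟨
      sum (λ k → 𝟙 (R? x k) + length (filter (λ y → R? y k) xs))
        ≡⟨ sum-cong (λ k → sym (length-filter-∷ (λ y → R? y k) x xs)) ⟩
      sum (λ k → length (filter (λ y → R? y k) (x ∷ xs))) ∎
      where open ≡-Reasoning

  boxSummation : ∀ {s} (κ : Fin s → ℕ) → Summation (Fin s → ℕ)
  boxSummation κ = record
    { sum      = sumBelow κ
    ; sum-cong = sumBelow-cong κ
    ; sum-+    = sumBelow-+ κ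
    ; sum-zero = sumBelow-vanish κ _ (λ _ → refl)
    }

  sumBelow-once : ∀ {s} (κ h : Fin s → ℕ) → h ⪯ κ → sumBelow κ (λ κ' → 𝟙 (≗-dec _≟_ h κ')) ≡ 1
  sumBelow-once κ h h⪯κ =
    trans (sumBelow-single κ _ h h⪯κ (λ κ' h≉κ' → 𝟙-no (≗-dec _≟_ h κ') h≉κ')
                                     (λ κ' h≗κ' → trans (𝟙-yes (≗-dec _≟_ h κ') h≗κ') (sym h-once)))
          h-once
    where h-once = 𝟙-yes (≗-dec _≟_ h h) (λ _ → refl)

  AllPairs-map : ∀ {A B : Set} {P : A → Set} {R : A → A → Set} {R' : B → B → Set} (f : A → B) →
                 (∀ {v w} → P v → P w → R v w → R' (f v) (f w)) →
                 ∀ {xs} → All P xs → AllPairs R xs → AllPairs R' (map f xs)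
  AllPairs-map f compat []         []         = []
  AllPairs-map f compat (pv ∷ pvs) (rv ∷ rvs) =
    All.map⁺ (All.zipWith (λ (pw , r) → compat pv pw r) (pvs , rv)) ∷ AllPairs-map f compat pvs rvs

module WordCounting where

  open FiniteSums
  open import Function using (_∘_)
  open import Data.Nat using (ℕ; zero; suc; pred; _+_; _*_; _∸_; _^_; _!; _≤_; _<_; _≤′_; ≤′-refl; ≤′-step;
                              _≤ᵇ_; _≤?_; NonZero; >-nonZero; >-nonZero⁻¹; z≤n; s≤s)
  open import Data.Nat.Properties
  open import Data.Nat.DivMod using (_/_; /-congˡ; m*n/n≡m)
  open import Data.Nat.Solver using (module +-*-Solver)
  open +-*-Solver using (solve; _:*_; _:=_)
  open import Data.Fin using (Fin) renaming (zero to fzero; suc to fsuc)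
  open import Data.Fin.Properties using (nonZeroIndex) renaming (_≟_ to _≟ᶠ_)
  open import Data.Fin.Subset using (Subset; inside; outside; _∈_; _∉_; ∣_∣)
  open import Data.Fin.Subset.Properties using (drop-there; ∣p∣≤∣x∷p∣)
  open import Data.Vec using ([]; _∷_; lookup; here)
  open import Data.Vec.Properties using ([]=⇒lookup; lookup⇒[]=)
  open import Data.Vec.Functional using (updateAt; tail)
  open import Data.Vec.Functional.Properties using (updateAt-updates; updateAt-minimal; ≗-dec)
  open import Data.Bool using (T; true; false; if_then_else_)
  open import Data.Bool.Properties using (T-≡)
  open import Data.Maybe using (Maybe; just; nothing)
  import Data.Maybe.Properties as Maybe
  open import Data.Product using (Σ; _×_; _,_; proj₁; uncurry)
  import Data.Product.Properties as Σ
  open import Data.List using (List; []; _∷_; length; filter; map; tabulate)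
  open import Data.List.Properties using (length-map; filter-none; length-tabulate)
  open import Data.List.Relation.Unary.All as All using (All; []; _∷_)
  import Data.List.Relation.Unary.All.Properties as All
  open import Data.List.Relation.Unary.AllPairs using (AllPairs; []; _∷_)
  import Data.List.Relation.Unary.AllPairs.Properties as AllPairs
  open import Function.Bundles using (Equivalence)
  open import Relation.Nullary using (¬_; yes; no; contradiction)
  open import Relation.Binary.Definitions using (DecidableEquality)
  open import Relation.Binary.PropositionalEquality
  open import Axiom.UniquenessOfIdentityProofs using (module Decidable⇒UIP)
  open import Algebra.Properties.CommutativeSemigroup +-commutativeSemigroup
    using () renaming (interchange to +-interchange)
  open import Algebra.Properties.CommutativeSemigroup *-commutativeSemigroup
    using () renaming (x∙yz≈y∙xz to x*[y*z]≡y*[x*z]; xy∙z≈xz∙y to [x*y]*z≡[x*z]*y)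

  _↓_ : ∀ {s} → (Fin s → ℕ) → Fin s → (Fin s → ℕ)
  κ ↓ i = updateAt κ i pred

  module _ {s} (κ : Fin s → ℕ) (i : Fin s) {c} (κi≡1+c : κ i ≡ suc c) where

    private
      ↓-at : (κ ↓ i) i ≡ c
      ↓-at = trans (updateAt-updates i κ) (cong pred κi≡1+c)

      ↓-away : ∀ j → j ≢ i → κ j ≡ (κ ↓ i) j
      ↓-away j j≢i = sym (updateAt-minimal j i κ j≢i)

    ↓-sum : sumFin κ ≡ suc (sumFin (κ ↓ i))
    ↓-sum = sumFin-update κ (κ ↓ i) i 1 ↓-away (trans κi≡1+c (cong suc (sym ↓-at)))

    ↓-factorials : prodFin (λ j → κ j !) ≡ suc c * prodFin (λ j → (κ ↓ i) j !)
    ↓-factorials = prodFin-update _ _ i (suc c) (λ j j≢i → cong _! (↓-away j j≢i))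
                     (trans (cong _! κi≡1+c) (cong (λ x → suc c * x !) (sym ↓-at)))

    ↓-powers : (l : Fin s → ℕ) → prodFin (λ j → l j ^ κ j) ≡ l i * prodFin (λ j → l j ^ (κ ↓ i) j)
    ↓-powers l = prodFin-update _ _ i (l i) (λ j j≢i → cong (l j ^_) (↓-away j j≢i))
                   (trans (cong (l i ^_) κi≡1+c) (cong (λ x → l i * l i ^ x) (sym ↓-at)))

  -- An alphabet has a free class of u letters
  -- and classes i < s of l i letters; W d κ is the number of words of length d
  -- containing exactly κ i letters of class i, computed by the first-letter recursion.
  module WordCount {s : ℕ} (u : ℕ) (l : Fin s → ℕ) where

    classSize : Maybe (Fin s) → ℕ
    classSize nothing  = u
    classSize (just i) = l i

    sumClasses : (Maybe (Fin s) → ℕ) → ℕ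
    sumClasses h = h nothing + sumFin (h ∘ just)

    whenPositive : ℕ → ℕ → ℕ
    whenPositive zero    x = 0
    whenPositive (suc _) x = x

    mutual
      W : ℕ → (Fin s → ℕ) → ℕ
      W zero    κ = 𝟙 (sumFin κ ≟ 0)
      W (suc d) κ = sumClasses (λ o → classSize o * W-after d κ o)

      -- words of length d that complete a first letter of class o to profile κ
      W-after : ℕ → (Fin s → ℕ) → Maybe (Fin s) → ℕ
      W-after d κ nothing  = W d κ
      W-after d κ (just i) = whenPositive (κ i) (W d (κ ↓ i))

    W-vanish : ∀ d κ → d < sumFin κ → W d κ ≡ 0
    W-vanish zero    κ 0<∣κ∣ = 𝟙-no (sumFin κ ≟ 0) (m<n⇒n≢0 0<∣κ∣)
    W-vanish (suc d) κ d<∣κ∣ =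
      cong₂ _+_ (trans (cong (u *_) (W-vanish d κ (<-trans (n<1+n d) d<∣κ∣))) (*-zeroʳ u))
                (trans (sumFin-cong class-vanish) (sumFin-zero {s}))
      where
      class-vanish : ∀ i → l i * W-after d κ (just i) ≡ 0
      class-vanish i with κ i in κi
      ... | zero  = *-zeroʳ (l i)
      ... | suc c = trans (cong (l i *_) (W-vanish d (κ ↓ i) d<∣κ↓i∣)) (*-zeroʳ (l i))
        where d<∣κ↓i∣ = ≤-pred (subst (suc (suc d) ≤_) (↓-sum κ i κi) d<∣κ∣)

    W-mono : 1 ≤ u → ∀ κ {d d'} → d ≤ d' → W d κ ≤ W d' κ
    W-mono 1≤u κ d≤d' = go (≤⇒≤′ d≤d')
      where
      go : ∀ {d d'} → d ≤′ d' → W d κ ≤ W d' κ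
      go ≤′-refl                 = ≤-refl
      go (≤′-step {n = d'} d≤d') = ≤-trans (go d≤d')
        (≤-trans (m≤n*m (W d' κ) u {{>-nonZero 1≤u}}) (m≤m+n (u * W d' κ) _))

    -- The denominator and weight of the multinomial formula
    --   W d κ = d! / (∏ κᵢ! (d - |κ|)!) · ∏ lᵢ^κᵢ · u^(d - |κ|).
    denominator : ℕ → (Fin s → ℕ) → ℕ
    denominator d κ = prodFin (λ i → κ i !) * (d ∸ sumFin κ) !

    weight : ℕ → (Fin s → ℕ) → ℕ
    weight d κ = prodFin (λ i → l i ^ κ i) * u ^ (d ∸ sumFin κ)

    denominator-free : ∀ d κ → sumFin κ ≤ d →
                       denominator (suc d) κ ≡ suc (d ∸ sumFin κ) * denominator d κ
    denominator-free d κ ∣κ∣≤d rewrite +-∸-assoc 1 ∣κ∣≤d =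
      x*[y*z]≡y*[x*z] (prodFin (λ i → κ i !)) (suc (d ∸ sumFin κ)) _

    weight-free : ∀ d κ → sumFin κ ≤ d → weight (suc d) κ ≡ u * weight d κ
    weight-free d κ ∣κ∣≤d rewrite +-∸-assoc 1 ∣κ∣≤d =
      x*[y*z]≡y*[x*z] (prodFin (λ i → l i ^ κ i)) u _

    denominator-class : ∀ d κ i {c} → κ i ≡ suc c →
                        denominator (suc d) κ ≡ suc c * denominator d (κ ↓ i)
    denominator-class d κ i {c} κi rewrite ↓-sum κ i κi | ↓-factorials κ i κi =
      *-assoc (suc c) (prodFin (λ j → (κ ↓ i) j !)) _

    weight-class : ∀ d κ i {c} → κ i ≡ suc c → weight (suc d) κ ≡ l i * weight d (κ ↓ i)
    weight-class d κ i κi rewrite ↓-sum κ i κi | ↓-powers κ i κi l =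
      *-assoc (l i) (prodFin (λ j → l j ^ (κ ↓ i) j)) _

    MultinomialIdentity : ℕ → Set
    MultinomialIdentity d = ∀ κ → sumFin κ ≤ d → W d κ * denominator d κ ≡ d ! * weight d κ

    free-letter-step : ∀ d → MultinomialIdentity d → ∀ κ → sumFin κ ≤ suc d →
      u * W d κ * denominator (suc d) κ ≡ (suc d ∸ sumFin κ) * (d ! * weight (suc d) κ)
    free-letter-step d identity κ ∣κ∣≤1+d with sumFin κ ≤? d
    ... | yes ∣κ∣≤d rewrite denominator-free d κ ∣κ∣≤d | weight-free d κ ∣κ∣≤d | +-∸-assoc 1 ∣κ∣≤d = begin
      u * W d κ * (suc e * denominator d κ)   ≡⟨ solve 4 (λ u w c D → u :* w :* (c :* D) := c :* (u :* (w :* D)))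
                                                   refl u (W d κ) (suc e) (denominator d κ) ⟩
      suc e * (u * (W d κ * denominator d κ)) ≡⟨ cong (λ x → suc e * (u * x)) (identity κ ∣κ∣≤d) ⟩
      suc e * (u * (d ! * weight d κ))        ≡⟨ cong (suc e *_) (x*[y*z]≡y*[x*z] u (d !) _) ⟩
      suc e * (d ! * (u * weight d κ))        ∎
      where open ≡-Reasoning
            e = d ∸ sumFin κ
    ... | no ∣κ∣≰d = begin
      u * W d κ * denominator (suc d) κ ≡⟨ cong (λ w → u * w * denominator (suc d) κ) (W-vanish d κ (≰⇒> ∣κ∣≰d)) ⟩
      u * 0 * denominator (suc d) κ     ≡⟨ cong (_* denominator (suc d) κ) (*-zeroʳ u) ⟩
      0                                 ≡⟨ cong (_* (d ! * weight (suc d) κ)) (m≤n⇒m∸n≡0 (≰⇒> ∣κ∣≰d)) ⟨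
      (suc d ∸ sumFin κ) * (d ! * weight (suc d) κ) ∎
      where open ≡-Reasoning

    class-letter-step : ∀ d → MultinomialIdentity d → ∀ κ → sumFin κ ≤ suc d → ∀ i →
      l i * W-after d κ (just i) * denominator (suc d) κ ≡ κ i * (d ! * weight (suc d) κ)
    class-letter-step d identity κ ∣κ∣≤1+d i with κ i in κi
    ... | zero  = cong (_* denominator (suc d) κ) (*-zeroʳ (l i))
    ... | suc c rewrite denominator-class d κ i κi | weight-class d κ i κi = begin
      l i * W d κ↓ * (suc c * denominator d κ↓)   ≡⟨ solve 4 (λ l w c D → l :* w :* (c :* D) := c :* (l :* (w :* D)))
                                                       refl (l i) (W d κ↓) (suc c) (denominator d κ↓) ⟩
      suc c * (l i * (W d κ↓ * denominator d κ↓)) ≡⟨ cong (λ x → suc c * (l i * x)) (identity κ↓ ∣κ↓∣≤d) ⟩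
      suc c * (l i * (d ! * weight d κ↓))         ≡⟨ cong (suc c *_) (x*[y*z]≡y*[x*z] (l i) (d !) _) ⟩
      suc c * (d ! * (l i * weight d κ↓))         ∎
      where open ≡-Reasoning
            κ↓ = κ ↓ i
            ∣κ↓∣≤d = ≤-pred (subst (_≤ suc d) (↓-sum κ i κi) ∣κ∣≤1+d)

    W-multinomial : ∀ d → MultinomialIdentity d
    W-multinomial zero κ ∣κ∣≤0 rewrite n≤0⇒n≡0 ∣κ∣≤0 =
      cong (λ x → 1 * (x * 1)) (trans (prodFin-cong λ i → cong _! (κ≡0 i))
                                      (prodFin-cong λ i → cong (l i ^_) (sym (κ≡0 i))))
      where κ≡0 = sumFin-zero⁻¹ κ (n≤0⇒n≡0 ∣κ∣≤0)
    W-multinomial (suc d) κ ∣κ∣≤1+d = begin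
      (u * W d κ + sumFin (λ i → l i * W-after d κ (just i))) * D
        ≡⟨ *-distribʳ-+ D (u * W d κ) _ ⟩
      u * W d κ * D + sumFin (λ i → l i * W-after d κ (just i)) * D
        ≡⟨ cong₂ _+_ (free-letter-step d (W-multinomial d) κ ∣κ∣≤1+d)
                     (trans (sym (sumFin-*ʳ (λ i → l i * W-after d κ (just i)) D))
                            (sumFin-cong (class-letter-step d (W-multinomial d) κ ∣κ∣≤1+d))) ⟩
      (suc d ∸ S) * Y + sumFin (λ i → κ i * Y)
        ≡⟨ cong ((suc d ∸ S) * Y +_) (sumFin-*ʳ κ Y) ⟩
      (suc d ∸ S) * Y + S * Y
        ≡⟨ *-distribʳ-+ Y (suc d ∸ S) S ⟨
      (suc d ∸ S + S) * Y
        ≡⟨ cong (_* Y) (m∸n+n≡m ∣κ∣≤1+d) ⟩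
      suc d * (d ! * weight (suc d) κ)
        ≡⟨ *-assoc (suc d) (d !) _ ⟨
      suc d ! * weight (suc d) κ ∎
      where
      open ≡-Reasoning
      S = sumFin κ
      D = denominator (suc d) κ
      Y = d ! * weight (suc d) κ

  ≤ᵇ-true : ∀ {m n} → m ≤ n → (m ≤ᵇ n) ≡ true
  ≤ᵇ-true m≤n = Equivalence.to T-≡ (≤⇒≤ᵇ m≤n)

  ≤ᵇ-false : ∀ {m n} → ¬ m ≤ n → (m ≤ᵇ n) ≡ false
  ≤ᵇ-false {m} {n} m≰n with m ≤ᵇ n in m≤ᵇn
  ... | false = refl
  ... | true  = contradiction (≤ᵇ⇒≤ m n (subst T (sym m≤ᵇn) _)) m≰n

  -- The number of words with a given profile is the multinomial coefficient times
  -- the weight; for u = 1 and lᵢ = 1 the identity above computes the coefficient itself.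
  module _ {s : ℕ} (u : ℕ) (l : Fin s → ℕ) where
    open WordCount u l
    private module Arrangements = WordCount 1 (λ (_ : Fin s) → 1)

    W-closed : ∀ d κ → W d κ ≡ multinom d κ * weight d κ
    W-closed d κ with sumFin κ ≤? d
    ... | no ∣κ∣≰d rewrite ≤ᵇ-false ∣κ∣≰d = W-vanish d κ (≰⇒> ∣κ∣≰d)
    ... | yes ∣κ∣≤d rewrite ≤ᵇ-true ∣κ∣≤d =
      *-cancelʳ-≡ (W d κ) _ (denominator d κ) (begin
        W d κ * denominator d κ                  ≡⟨ W-multinomial d κ ∣κ∣≤d ⟩
        d ! * weight d κ                         ≡⟨ cong (_* weight d κ) d!≡A*D ⟩
        A * denominator d κ * weight d κ         ≡⟨ [x*y]*z≡[x*z]*y A (denominator d κ) (weight d κ) ⟩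
        A * weight d κ * denominator d κ         ≡⟨ cong (λ x → x * weight d κ * denominator d κ) A≡multinom ⟩
        (d ! / denominator d κ) * weight d κ * denominator d κ ∎)
      where
      open ≡-Reasoning
      A = Arrangements.W d κ
      instance
        denominator≢0 : NonZero (denominator d κ)
        denominator≢0 = m*n≢0 _ _ {{prodFact-nonZero κ}} {{(d ∸ sumFin κ) !≢0}}
      d!≡A*D : d ! ≡ A * denominator d κ
      d!≡A*D = sym (trans (Arrangements.W-multinomial d κ ∣κ∣≤d)
                          (trans (cong (d ! *_) unit-weight) (*-identityʳ (d !))))
        where
        unit-weight : Arrangements.weight d κ ≡ 1
        unit-weight = cong₂ _*_ (trans (prodFin-cong λ i → ^-zeroˡ (κ i)) (prodFin-one {s})) (^-zeroˡ (d ∸ sumFin κ))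
      A≡multinom : A ≡ d ! / denominator d κ
      A≡multinom = sym (trans (/-congˡ d!≡A*D) (m*n/n≡m A (denominator d κ)))

  module Words {s : ℕ} (u : ℕ) (l : Fin s → ℕ) where
    open WordCount u l

    Letter : Set
    Letter = Σ (Maybe (Fin s)) (Fin ∘ classSize)

    class : Letter → Maybe (Fin s)
    class = proj₁

    _≟ˡ_ : DecidableEquality Letter
    _≟ˡ_ = Σ.≡-dec (Maybe.≡-dec _≟ᶠ_) _≟ᶠ_

    hits : Maybe (Fin s) → Fin s → ℕ
    hits nothing  i = 0
    hits (just j) i = 𝟙 (j ≟ᶠ i)

    profile : ∀ {m} → (Fin m → Letter) → Fin s → ℕ
    profile {zero}  w i = 0
    profile {suc m} w i = hits (class (w fzero)) i + profile (w ∘ fsuc) i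

    sumClasses-cong : ∀ {g h : Maybe (Fin s) → ℕ} → (∀ o → g o ≡ h o) → sumClasses g ≡ sumClasses h
    sumClasses-cong g≗h = cong₂ _+_ (g≗h nothing) (sumFin-cong (g≗h ∘ just))

    sumClasses-+ : ∀ (g h : Maybe (Fin s) → ℕ) → sumClasses (λ o → g o + h o) ≡ sumClasses g + sumClasses h
    sumClasses-+ g h = trans (cong (g nothing + h nothing +_) (sumFin-+ (g ∘ just) (h ∘ just)))
                             (+-interchange (g nothing) (h nothing) _ _)

    sumClasses-single : ∀ (g : Maybe (Fin s) → ℕ) o → (∀ o' → o' ≢ o → g o' ≡ 0) → sumClasses g ≡ g o
    sumClasses-single g nothing  vanish =
      trans (cong (g nothing +_) (trans (sumFin-cong λ i → vanish (just i) λ ()) (sumFin-zero {s})))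
            (+-identityʳ _)
    sumClasses-single g (just i) vanish =
      trans (cong (_+ sumFin (g ∘ just)) (vanish nothing λ ()))
            (sumFin-single (g ∘ just) i λ j j≢i → vanish (just j) (j≢i ∘ Maybe.just-injective))

    sumLetters : (Letter → ℕ) → ℕ
    sumLetters g = sumClasses (λ o → sumFin (λ j → g (o , j)))

    letterSummation : Summation Letter
    letterSummation = record
      { sum      = sumLetters
      ; sum-cong = λ g≗h → sumClasses-cong λ o → sumFin-cong λ j → g≗h (o , j)
      ; sum-+    = λ g h → trans (sumClasses-cong λ o → sumFin-+ (λ j → g (o , j)) (λ j → h (o , j)))
                                 (sumClasses-+ (λ o → sumFin (λ j → g (o , j))) (λ o → sumFin (λ j → h (o , j))))
      ; sum-zero = trans (sumClasses-cong λ o → sumFin-zero {classSize o})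
                         (sumClasses-single (λ _ → 0) nothing λ _ _ → refl)
      }

    sumLetters-once : ∀ x → sumLetters (λ y → 𝟙 (x ≟ˡ y)) ≡ 1
    sumLetters-once x@(o , j) = begin
      sumLetters (λ y → 𝟙 (x ≟ˡ y))
        ≡⟨ sumClasses-single _ o (λ o' o'≢o → trans (sumFin-cong λ j' → 𝟙-no (x ≟ˡ (o' , j')) (o'≢o ∘ sym ∘ cong proj₁))
                                                    (sumFin-zero {classSize o'})) ⟩
      sumFin (λ j' → 𝟙 (x ≟ˡ (o , j')))
        ≡⟨ sumFin-single _ j (λ j' j'≢j → 𝟙-no (x ≟ˡ (o , j')) (j'≢j ∘ sym ∘ Σ.,-injectiveʳ-UIP classes-UIP)) ⟩
      𝟙 (x ≟ˡ x)
        ≡⟨ 𝟙-yes (x ≟ˡ x) refl ⟩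
      1 ∎
      where open ≡-Reasoning
            classes-UIP = Decidable⇒UIP.≡-irrelevant (Maybe.≡-dec _≟ᶠ_)

    sumLetters-mono : ∀ {g h : Letter → ℕ} → (∀ y → g y ≤ h y) → sumLetters g ≤ sumLetters h
    sumLetters-mono g≤h = +-mono-≤ (sumFin-mono (g≤h ∘ (nothing ,_)))
                                   (sumFin-mono λ i → sumFin-mono (g≤h ∘ (just i ,_)))

    Distinct : ∀ {m} → List (Fin m → Letter) → Set
    Distinct = AllPairs (λ v w → ¬ (v ≗ w))

    Admissible : ∀ {m} → Letter → Subset m → (Fin s → ℕ) → (Fin m → Letter) → Set
    Admissible b I κ w = (∀ p → p ∉ I → w p ≡ b) × profile w ≗ κ

    drop-first : ∀ {m} (b y : Letter) x (I : Subset m) κ κ' → (∀ i → hits (class y) i + κ' i ≡ κ i) →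
                 (ys : List (Fin (suc m) → Letter)) → All (λ w → w fzero ≡ y) ys → Distinct ys →
                 All (Admissible b (x ∷ I) κ) ys →
                 Distinct (map tail ys) × All (Admissible b I κ') (map tail ys)
    drop-first b y x I κ κ' split ys first≡y distinct admissible =
      AllPairs-map tail tails-differ first≡y distinct ,
      All.map⁺ (All.zipWith tail-admissible (first≡y , admissible))
      where
      tails-differ : ∀ {v w} → v fzero ≡ y → w fzero ≡ y → ¬ (v ≗ w) → ¬ (tail v ≗ tail w)
      tails-differ v₀≡y w₀≡y v≉w tails≗ = v≉w λ { fzero → trans v₀≡y (sym w₀≡y) ; (fsuc p) → tails≗ p }
      tail-admissible : ∀ {w} → w fzero ≡ y × Admissible b (x ∷ I) κ w → Admissible b I κ' (tail w)
      tail-admissible (w₀≡y , outside≡b , w≗κ) =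
        (λ p p∉I → outside≡b (fsuc p) (p∉I ∘ drop-there)) ,
        (λ i → +-cancelˡ-≡ (hits (class y) i) _ _ (trans (cong (λ z → hits (class z) i + _) (sym w₀≡y))
                                                          (trans (w≗κ i) (sym (split i)))))

    hits-↓ : ∀ κ j {c} → κ j ≡ suc c → ∀ i → hits (just j) i + (κ ↓ j) i ≡ κ i
    hits-↓ κ j κj≡1+c i with j ≟ᶠ i
    ... | yes refl = trans (cong suc (updateAt-updates j κ)) (trans (cong (suc ∘ pred) κj≡1+c) (sym κj≡1+c))
    ... | no  j≢i  = updateAt-minimal i j κ (j≢i ∘ sym)

    count-words : ∀ {m} (b : Fin u) (I : Subset m) κ (xs : List (Fin m → Letter)) →
                  Distinct xs → All (Admissible (nothing , b) I κ) xs → length xs ≤ W ∣ I ∣ κ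
    count-words b []            κ []          _                 _ = z≤n
    count-words b []            κ (w ∷ [])    _                 ((_ , w≗κ) ∷ []) =
      ≤-reflexive (sym (𝟙-yes (sumFin κ ≟ 0) (trans (sumFin-cong (sym ∘ w≗κ)) (sumFin-zero {s}))))
    count-words b []            κ (v ∷ w ∷ _) ((v≉w ∷ _) ∷ _) _ = contradiction (λ ()) v≉w
    count-words b (outside ∷ I) κ xs distinct admissible =
      subst (_≤ W ∣ I ∣ κ) (length-map tail xs) (uncurry (count-words b I κ (map tail xs))
        (drop-first (nothing , b) (nothing , b) outside I κ κ (λ _ → refl) xs first≡b distinct admissible))
      where
      first≡b = All.map (λ (outside≡b , _) → outside≡b fzero λ ()) admissible
    count-words {suc m} b (inside ∷ I) κ xs distinct admissible = begin
      length xs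
        ≡⟨ length-partition letterSummation (λ w y → w fzero ≡ y) (λ w y → w fzero ≟ˡ y) xs
             (All.map (λ {w} _ → sumLetters-once (w fzero)) admissible) ⟩
      sumLetters (λ y → length (group y))
        ≤⟨ sumLetters-mono group-bound ⟩
      sumLetters (λ y → W-after ∣ I ∣ κ (class y))
        ≡⟨ sumClasses-cong (λ o → sumFin-const {classSize o} (W-after ∣ I ∣ κ o)) ⟩
      W (suc ∣ I ∣) κ ∎
      where
      open ≤-Reasoning
      group : Letter → List (Fin (suc m) → Letter)
      group y = filter (λ w → w fzero ≟ˡ y) xs

      tails-bound : ∀ y κ' → (∀ i → hits (class y) i + κ' i ≡ κ i) → length (group y) ≤ W ∣ I ∣ κ'
      tails-bound y κ' split =
        subst (_≤ W ∣ I ∣ κ') (length-map tail (group y)) (uncurry (count-words b I κ' _)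
          (drop-first (nothing , b) y inside I κ κ' split (group y)
            (All.all-filter (λ w → w fzero ≟ˡ y) xs)
            (AllPairs.filter⁺ (λ w → w fzero ≟ˡ y) distinct)
            (All.filter⁺ (λ w → w fzero ≟ˡ y) admissible)))

      group-bound : ∀ y → length (group y) ≤ W-after ∣ I ∣ κ (class y)
      group-bound y@(nothing , _) = tails-bound y κ (λ _ → refl)
      group-bound y@(just j  , _) with κ j in κj
      ... | suc c = tails-bound y (κ ↓ j) (hits-↓ κ j κj)
      ... | zero  = ≤-reflexive (cong length (filter-none (λ w → w fzero ≟ˡ y) (All.map no-word admissible)))
        where
        -- a word starting with a letter of class j has a positive j-entry in its profile
        no-word : ∀ {w} → Admissible (nothing , b) (inside ∷ I) κ w → w fzero ≢ y
        no-word {w} (_ , w≗κ) w₀≡y = 1+n≢0 (begin-equality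
          suc (profile (tail w) j)                      ≡⟨ cong (_+ profile (tail w) j) (𝟙-yes (j ≟ᶠ j) refl) ⟨
          hits (class y) j + profile (tail w) j         ≡⟨ cong (λ z → hits (class z) j + profile (tail w) j) w₀≡y ⟨
          profile w j                                   ≡⟨ trans (w≗κ j) κj ⟩
          0                                             ∎)

    count-families : ∀ {m n} (b : Fin u) (I : Subset m) r → ∣ I ∣ ≤ r → (κ : Fin s → ℕ) →
                     (word : Fin n → Fin m → Letter) → (∀ a a' → word a ≗ word a' → a ≡ a') →
                     (∀ a p → p ∉ I → word a p ≡ (nothing , b)) → (∀ a → profile (word a) ⪯ κ) →
                     n ≤ sumBelow κ (λ κ' → multinom r κ' * weight r κ')
    count-families {n = n} b I r ∣I∣≤r κ word injective supported bounded = begin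
      n
        ≡⟨ length-tabulate word ⟨
      length xs
        ≡⟨ length-partition (boxSummation κ) (λ w κ' → profile w ≗ κ') (λ w κ' → ≗-dec _≟_ (profile w) κ') xs
             (All.tabulate⁺ λ a → sumBelow-once κ (profile (word a)) (bounded a)) ⟩
      sumBelow κ (λ κ' → length (with-profile κ'))
        ≤⟨ sumBelow-mono κ (λ κ' → count-words b I κ' (with-profile κ')
             (AllPairs.filter⁺ (λ w → ≗-dec _≟_ (profile w) κ') distinct)
             (All.zip (All.filter⁺ (λ w → ≗-dec _≟_ (profile w) κ') (All.tabulate⁺ supported) ,
                       All.all-filter (λ w → ≗-dec _≟_ (profile w) κ') xs))) ⟩
      sumBelow κ (λ κ' → W ∣ I ∣ κ')
        ≤⟨ sumBelow-mono κ (λ κ' → W-mono 1≤u κ' ∣I∣≤r) ⟩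
      sumBelow κ (λ κ' → W r κ')
        ≡⟨ sumBelow-cong κ (W-closed u l r) ⟩
      sumBelow κ (λ κ' → multinom r κ' * weight r κ') ∎
      where
      open ≤-Reasoning
      xs = tabulate word
      distinct : Distinct xs
      distinct = AllPairs.tabulate⁺ λ a≢a' word≗ → a≢a' (injective _ _ word≗)
      with-profile : (Fin s → ℕ) → List (Fin _ → Letter)
      with-profile κ' = filter (λ w → ≗-dec _≟_ (profile w) κ') xs
      1≤u : 1 ≤ u
      1≤u = >-nonZero⁻¹ u {{nonZeroIndex b}}

    profile-bound : ∀ {m} (w : Fin m → Letter) i (S : Subset m) →
                    (∀ p → class (w p) ≡ just i → p ∈ S) → profile w i ≤ ∣ S ∣
    profile-bound {zero}  w i []      inS = z≤n
    profile-bound {suc m} w i (x ∷ S) inS =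
      first-letter (class (w fzero)) refl (profile-bound (tail w) i S (λ p c → drop-there (inS (fsuc p) c)))
      where
      first-letter : ∀ o → class (w fzero) ≡ o → profile (tail w) i ≤ ∣ S ∣ →
                     hits o i + profile (tail w) i ≤ ∣ x ∷ S ∣
      first-letter nothing  _  rest = ≤-trans rest (∣p∣≤∣x∷p∣ x S)
      first-letter (just j) c₀ rest with j ≟ᶠ i
      ... | no _     = ≤-trans rest (∣p∣≤∣x∷p∣ x S)
      ... | yes refl with inS fzero c₀
      ...   | here = s≤s rest

    restrict : ∀ {m} → Fin u → Subset m → (Fin m → Letter) → (Fin m → Letter)
    restrict b I w p = if lookup I p then w p else (nothing , b)

    restrict-inside : ∀ {m} b (I : Subset m) w p → p ∈ I → restrict b I w p ≡ w p
    restrict-inside b I w p p∈I rewrite []=⇒lookup p∈I = refl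

    restrict-outside : ∀ {m} b (I : Subset m) w p → p ∉ I → restrict b I w p ≡ (nothing , b)
    restrict-outside b I w p p∉I with lookup I p in I[p]
    ... | true  = contradiction (lookup⇒[]= p I I[p]) p∉I
    ... | false = refl

    restrict-profile : ∀ {m} b (I : Subset m) w → profile (restrict b I w) ⪯ profile w
    restrict-profile b []            w i = z≤n
    restrict-profile b (inside  ∷ I) w i = +-monoʳ-≤ (hits (class (w fzero)) i) (restrict-profile b I (tail w) i)
    restrict-profile b (outside ∷ I) w i = ≤-trans (restrict-profile b I (tail w) i) (m≤n+m _ _)

-- A set I of coordinates is an information set for vectors
-- b₀, …, b_{r-1} ∈ F^m if every linear combination of them vanishing on I vanishes.
-- Gaussian elimination yields one of size at most r; since equality in F need not
-- be decidable, its existence is established under double negation.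
module InformationSets where

  open import Level using (Level; _⊔_)
  open import Function using (_∘_)
  open import Data.Nat using (zero; suc; _≤_; z≤n; s≤s) renaming (_+_ to _+ℕ_)
  open import Data.Nat.Properties using (≤-trans; ≤-reflexive; +-monoʳ-≤; +-suc; m≤n⇒m≤1+n)
  open import Data.Fin using (Fin) renaming (zero to fzero; suc to fsuc)
  open import Data.Fin.Subset using (Subset; inside; outside; _∈_; ∣_∣; _∪_; ⁅_⁆) renaming (⊥ to ∅)
  open import Data.Fin.Subset.Properties using (∣p∣≤∣x∷p∣; ∣⊥∣≡0; ∣⁅x⁆∣≡1; x∈⁅x⁆; x∈p∪q⁺)
  open import Data.Vec using ([]; _∷_)
  open import Data.Product using (Σ; _×_; _,_; proj₁; proj₂)
  open import Data.Sum using (inj₁; inj₂)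
  open import Relation.Nullary using (¬_; yes; no)
  open import Relation.Nullary.Decidable using (¬¬-excluded-middle)
  open import Relation.Binary.PropositionalEquality as ≡ using (_≡_)

  ∣p∪q∣≤∣p∣+∣q∣ : ∀ {n} (p q : Subset n) → ∣ p ∪ q ∣ ≤ ∣ p ∣ +ℕ ∣ q ∣
  ∣p∪q∣≤∣p∣+∣q∣ []            []            = z≤n
  ∣p∪q∣≤∣p∣+∣q∣ (inside  ∷ p) (t ∷ q)       =
    s≤s (≤-trans (∣p∪q∣≤∣p∣+∣q∣ p q) (+-monoʳ-≤ ∣ p ∣ (∣p∣≤∣x∷p∣ t q)))
  ∣p∪q∣≤∣p∣+∣q∣ (outside ∷ p) (outside ∷ q) = ∣p∪q∣≤∣p∣+∣q∣ p q
  ∣p∪q∣≤∣p∣+∣q∣ (outside ∷ p) (inside  ∷ q) =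
    ≤-trans (s≤s (∣p∪q∣≤∣p∣+∣q∣ p q)) (≤-reflexive (≡.sym (+-suc ∣ p ∣ ∣ q ∣)))

  ∣⁅p⁆∪I∣≤1+r : ∀ {n r} (p : Fin n) I → ∣ I ∣ ≤ r → ∣ ⁅ p ⁆ ∪ I ∣ ≤ suc r
  ∣⁅p⁆∪I∣≤1+r {r = r} p I ∣I∣≤r = ≤-trans (∣p∪q∣≤∣p∣+∣q∣ ⁅ p ⁆ I)
    (≡.subst (λ x → x +ℕ ∣ I ∣ ≤ suc r) (≡.sym (∣⁅x⁆∣≡1 p)) (s≤s ∣I∣≤r))

  ¬¬-∀-Fin : ∀ {a m} {P : Fin m → Set a} → (∀ p → ¬ ¬ P p) → ¬ ¬ (∀ p → P p)
  ¬¬-∀-Fin {m = zero}  ¬¬P k = k λ ()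
  ¬¬-∀-Fin {m = suc m} ¬¬P k =
    ¬¬P fzero λ P₀ → ¬¬-∀-Fin (¬¬P ∘ fsuc) λ P₊ → k λ { fzero → P₀ ; (fsuc p) → P₊ p }

  module _ {c ℓ : Level} (F : Field c ℓ) where
    open Field F
    open import Algebra.Properties.CommutativeMonoid.Sum +-commutativeMonoid
      using (sum; sum-cong-≋; ∑-distrib-+; sum-replicate-zero)
    open import Algebra.Properties.Semiring.Sum semiring using (*-distribˡ-sum; *-distribʳ-sum)
    open import Algebra.Properties.Ring ring using (-1*x≈-x; -‿distribˡ-*)
    open import Algebra.Properties.AbelianGroup +-abelianGroup using (x∙y⁻¹≈ε⇒x≈y; x≈y⇒x∙y⁻¹≈ε)
    open import Algebra.Properties.CommutativeSemigroup +-commutativeSemigroup using (x∙yz≈xz∙y)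
    open import Relation.Binary.Reasoning.Setoid setoid

    -- The sum ∑ of Defs is the library sum, whose algebraic lemmas are used below.
    ∑≡sum : ∀ {n} (f : Fin n → Carrier) → ∑ F f ≡ sum f
    ∑≡sum {zero}  f = ≡.refl
    ∑≡sum {suc n} f = ≡.cong (f fzero +_) (∑≡sum (f ∘ fsuc))

    combination : ∀ {r m} → (Fin r → Carrier) → (Fin r → Fin m → Carrier) → Fin m → Carrier
    combination α b p = sum (λ j → α j * b j p)

    InformationSet : ∀ {r m} → (Fin r → Fin m → Carrier) → Subset m → Set (c ⊔ ℓ)
    InformationSet b I = ∀ α → (∀ p → p ∈ I → combination α b p ≈ 0#) → ∀ p → combination α b p ≈ 0#

    combination-zero : ∀ {r m} α (b : Fin r → Fin m → Carrier) p → (∀ j → b j p ≈ 0#) → combination α b p ≈ 0#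
    combination-zero {r} α b p b≈0 =
      trans (sum-cong-≋ λ j → trans (*-congˡ (b≈0 j)) (zeroʳ (α j))) (sum-replicate-zero r)

    combination-difference : ∀ {r m} (x y : Fin r → Carrier) (b : Fin r → Fin m → Carrier) p →
      combination (λ j → x j - y j) b p ≈ combination x b p - combination y b p
    combination-difference {r} x y b p = begin
      sum (λ j → (x j - y j) * b j p)                          ≈⟨ sum-cong-≋ (λ j → distribʳ (b j p) (x j) (- y j)) ⟩
      sum (λ j → x j * b j p + - y j * b j p)                  ≈⟨ ∑-distrib-+ (λ j → x j * b j p) (λ j → - y j * b j p) ⟩
      combination x b p + sum (λ j → - y j * b j p)            ≈⟨ +-congˡ (sum-cong-≋ λ j → trans (sym (-‿distribˡ-* (y j) (b j p)))
                                                                                          (sym (-1*x≈-x _))) ⟩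
      combination x b p + sum (λ j → - 1# * (y j * b j p))     ≈⟨ +-congˡ (*-distribˡ-sum (- 1#) (λ j → y j * b j p)) ⟨
      combination x b p + - 1# * combination y b p             ≈⟨ +-congˡ (-1*x≈-x _) ⟩
      combination x b p - combination y b p                    ∎

    drop-zero-vector : ∀ {r m} (b : Fin (suc r) → Fin m → Carrier) → (∀ p → b fzero p ≈ 0#) →
                       ∀ I → InformationSet (b ∘ fsuc) I → InformationSet b I
    drop-zero-vector b b₀≈0 I info α vanishes p =
      trans (drop p) (info (α ∘ fsuc) (λ q q∈I → trans (sym (drop q)) (vanishes q q∈I)) p)
      where
      drop : ∀ p → combination α b p ≈ combination (α ∘ fsuc) (b ∘ fsuc) p
      drop p = trans (+-congʳ (trans (*-congˡ (b₀≈0 p)) (zeroʳ (α fzero)))) (+-identityˡ _)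

    -- Elimination with a pivot b₀(p₀) ≉ 0: clearing coordinate p₀ from b₁, …, b_r.
    module Pivot {r m} (b : Fin (suc r) → Fin m → Carrier) (p₀ : Fin m) (pivot : ¬ (b fzero p₀ ≈ 0#)) where

      β : Carrier
      β = proj₁ (inverse (b fzero p₀) pivot)

      b₀p₀β≈1 : b fzero p₀ * β ≈ 1#
      b₀p₀β≈1 = proj₂ (inverse (b fzero p₀) pivot)

      factor : Fin r → Carrier
      factor j = b (fsuc j) p₀ * β

      eliminated : Fin r → Fin m → Carrier
      eliminated j p = b (fsuc j) p - factor j * b fzero p

      eliminated-at-pivot : ∀ j → eliminated j p₀ ≈ 0#
      eliminated-at-pivot j = begin
        b (fsuc j) p₀ - b (fsuc j) p₀ * β * b fzero p₀   ≈⟨ +-congˡ (-‿cong (*-assoc _ β _)) ⟩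
        b (fsuc j) p₀ - b (fsuc j) p₀ * (β * b fzero p₀) ≈⟨ +-congˡ (-‿cong (*-congˡ (trans (*-comm β _) b₀p₀β≈1))) ⟩
        b (fsuc j) p₀ - b (fsuc j) p₀ * 1#              ≈⟨ +-congˡ (-‿cong (*-identityʳ _)) ⟩
        b (fsuc j) p₀ - b (fsuc j) p₀                   ≈⟨ -‿inverseʳ _ ⟩
        0#                                              ∎

      restore : ∀ j p → eliminated j p + factor j * b fzero p ≈ b (fsuc j) p
      restore j p = trans (+-assoc _ _ _) (trans (+-congˡ (-‿inverseˡ _)) (+-identityʳ _))

      -- the coefficient of b₀ once b₁, …, b_r are replaced by the eliminated vectors
      pivot-coefficient : (Fin (suc r) → Carrier) → Carrier
      pivot-coefficient α = α fzero + sum (λ j → α (fsuc j) * factor j)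

      split : ∀ α p → combination α b p ≈
                      pivot-coefficient α * b fzero p + combination (α ∘ fsuc) eliminated p
      split α p = begin
        α fzero * b fzero p + sum (λ j → α (fsuc j) * b (fsuc j) p)
          ≈⟨ +-congˡ (sum-cong-≋ λ j → trans (*-congˡ (sym (restore j p)))
                                       (trans (distribˡ _ _ _) (+-congˡ (sym (*-assoc _ _ _))))) ⟩
        α fzero * b fzero p + sum (λ j → α (fsuc j) * eliminated j p + α (fsuc j) * factor j * b fzero p)
          ≈⟨ +-congˡ (∑-distrib-+ (λ j → α (fsuc j) * eliminated j p) (λ j → α (fsuc j) * factor j * b fzero p)) ⟩
        α fzero * b fzero p + (combination (α ∘ fsuc) eliminated p + sum (λ j → α (fsuc j) * factor j * b fzero p))
          ≈⟨ +-congˡ (+-congˡ (sym (*-distribʳ-sum (b fzero p) (λ j → α (fsuc j) * factor j)))) ⟩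
        α fzero * b fzero p + (combination (α ∘ fsuc) eliminated p + sum (λ j → α (fsuc j) * factor j) * b fzero p)
          ≈⟨ x∙yz≈xz∙y _ _ _ ⟩
        α fzero * b fzero p + sum (λ j → α (fsuc j) * factor j) * b fzero p + combination (α ∘ fsuc) eliminated p
          ≈⟨ +-congʳ (sym (distribʳ _ _ _)) ⟩
        pivot-coefficient α * b fzero p + combination (α ∘ fsuc) eliminated p ∎

      pivot-step : ∀ I → InformationSet eliminated I → InformationSet b (⁅ p₀ ⁆ ∪ I)
      pivot-step I info α vanishes p =
        trans (reduce p) (info (α ∘ fsuc) (λ q q∈I → trans (sym (reduce q)) (vanishes q (x∈p∪q⁺ (inj₂ q∈I)))) p)
        where
        -- at p₀ only the multiple of b₀ survives, so its coefficient γ vanishes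
        γ = pivot-coefficient α
        γb₀p₀≈0 : γ * b fzero p₀ ≈ 0#
        γb₀p₀≈0 = begin
          γ * b fzero p₀
            ≈⟨ +-identityʳ _ ⟨
          γ * b fzero p₀ + 0#
            ≈⟨ +-congˡ (combination-zero (α ∘ fsuc) eliminated p₀ eliminated-at-pivot) ⟨
          γ * b fzero p₀ + combination (α ∘ fsuc) eliminated p₀
            ≈⟨ split α p₀ ⟨
          combination α b p₀
            ≈⟨ vanishes p₀ (x∈p∪q⁺ (inj₁ (x∈⁅x⁆ p₀))) ⟩
          0# ∎
        γ≈0 : γ ≈ 0#
        γ≈0 = begin
          γ                      ≈⟨ *-identityʳ γ ⟨
          γ * 1#                 ≈⟨ *-congˡ b₀p₀β≈1 ⟨
          γ * (b fzero p₀ * β)   ≈⟨ *-assoc γ _ β ⟨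
          γ * b fzero p₀ * β     ≈⟨ *-congʳ γb₀p₀≈0 ⟩
          0# * β                 ≈⟨ zeroˡ β ⟩
          0#                     ∎
        reduce : ∀ q → combination α b q ≈ combination (α ∘ fsuc) eliminated q
        reduce q = trans (split α q) (trans (+-congʳ (trans (*-congʳ γ≈0) (zeroˡ _))) (+-identityˡ _))

    information-set : ∀ {r m} (b : Fin r → Fin m → Carrier) →
                      ¬ ¬ (Σ (Subset m) λ I → ∣ I ∣ ≤ r × InformationSet b I)
    information-set {zero}  {m} b k = k (∅ , ≤-reflexive (∣⊥∣≡0 m) , λ α _ p → refl)
    information-set {suc r} {m} b k = ¬¬-excluded-middle {A = Σ (Fin m) λ p → ¬ (b fzero p ≈ 0#)} λ where
      (yes (p₀ , pivot)) → information-set (Pivot.eliminated b p₀ pivot) λ (I , ∣I∣≤r , info) →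
        k (⁅ p₀ ⁆ ∪ I , ∣⁅p⁆∪I∣≤1+r p₀ I ∣I∣≤r , Pivot.pivot-step b p₀ pivot I info)
      (no no-pivot) → ¬¬-∀-Fin (λ p b₀p≉0 → no-pivot (p , b₀p≉0)) λ b₀≈0 →
        information-set (b ∘ fsuc) λ (I , ∣I∣≤r , info) →
        k (I , m≤n⇒m≤1+n ∣I∣≤r , drop-zero-vector b b₀≈0 I info)

    agree-on-information-set : ∀ {r m n} (M : Matrix F m n) (b : Fin r → Fin m → Carrier) (coeff : Fin n → Fin r → Carrier) →
      (∀ p a → M p a ≈ ∑ F (λ j → coeff a j * b j p)) → ∀ {I} → InformationSet b I →
      ∀ a a' → (∀ p → p ∈ I → M p a ≈ M p a') → ∀ p → M p a ≈ M p a'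
    agree-on-information-set M b coeff columns info a a' agree p =
      x∙y⁻¹≈ε⇒x≈y _ _ (trans (sym (difference p)) (info (λ j → coeff a j - coeff a' j)
        (λ q q∈I → trans (difference q) (x≈y⇒x∙y⁻¹≈ε (agree q q∈I))) p))
      where
      expansion : ∀ a p → M p a ≈ combination (coeff a) b p
      expansion a p = trans (columns p a) (reflexive (∑≡sum (λ j → coeff a j * b j p)))
      difference : ∀ p → combination (λ j → coeff a j - coeff a' j) b p ≈ M p a - M p a'
      difference p = trans (combination-difference (coeff a) (coeff a') b p)
                           (sym (+-cong (expansion a p) (-‿cong (expansion a' p))))

-- Encode every entry of a matrix by a letter from which it can be
-- read back.  For distinct columns of a matrix of rank ≤ r, restricting the letter
-- words to an information set keeps them distinct, so the word count applies.
module ColumnBound where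

  open import Level using (Level)
  open import Data.Nat using (ℕ; _≤_; _≤?_; _*_)
  open import Data.Nat.Properties using (≤-trans)
  open import Data.Fin using (Fin)
  open import Data.Fin.Properties using (_≟_)
  open import Data.Fin.Subset using (_∈_)
  open import Data.Product using (_,_)
  open import Relation.Nullary using (yes; no)
  open import Relation.Nullary.Decidable using (decidable-stable)
  open import Relation.Nullary.Negation using (contradiction)
  open import Relation.Binary.PropositionalEquality as ≡ using (_≡_; _≗_)
  open FiniteSums using (_⪯_)
  open WordCounting using (module WordCount; module Words)
  open InformationSets using (InformationSet; information-set; agree-on-information-set)

  module _ {c ℓ : Level} (F : Field c ℓ) {s : ℕ} (u : ℕ) (l : Fin s → ℕ) where
    open Field F using (Carrier; _≈_; trans; sym; reflexive)
    open Words u l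
    open WordCount u l using (weight)

    column-bound : (b : Fin u) (value : Letter → Carrier) (r : ℕ) (κ : Fin s → ℕ) {m n : ℕ} (M : Matrix F m n) →
      RankAtMost F r M → DistinctColumns F M →
      (letter : Fin n → Fin m → Letter) → (∀ a p → M p a ≈ value (letter a p)) →
      (∀ a → profile (letter a) ⪯ κ) →
      n ≤ sumBelow κ (λ κ' → multinom r κ' * weight r κ')
    -- The bound is decidable, so it may be derived from the doubly negated existence
    -- of an information set.
    column-bound b value r κ {m} {n} M (basis , coeff , columns) distinct letter decodes bounded =
      decidable-stable (n ≤? _) λ n≰bound → information-set F basis λ (I , ∣I∣≤r , info) →
        n≰bound (count-families b I r ∣I∣≤r κ (λ a → restrict b I (letter a)) (injective info)
                   (λ a → restrict-outside b I (letter a))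
                   (λ a i → ≤-trans (restrict-profile b I (letter a) i) (bounded a i)))
      where
      injective : ∀ {I} → InformationSet F basis I →
                  ∀ a a' → restrict b I (letter a) ≗ restrict b I (letter a') → a ≡ a'
      injective {I} info a a' same with a ≟ a'
      ... | yes a≡a' = a≡a'
      ... | no  a≢a' = contradiction (agree-on-information-set F M basis coeff columns info a a' agree-on-I)
                                     (distinct a a' a≢a')
        where
        agree-on-I : ∀ p → p ∈ I → M p a ≈ M p a'
        agree-on-I p p∈I = trans (decodes a p) (trans (reflexive (≡.cong value letters≡)) (sym (decodes a' p)))
          where letters≡ = ≡.trans (≡.sym (restrict-inside b I (letter a) p p∈I))
                                   (≡.trans (same p) (restrict-inside b I (letter a') p p∈I))

module Applications where

  open import Level using (Level)
  open import Function using (_∘_)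
  open import Data.Nat using (ℕ; zero; suc; NonZero; _≤_; _+_; _*_; _∸_; _^_; _!; _≤?_)
  open import Data.Nat.Properties
    using (≤-trans; ≤-reflexive; *-identityˡ; *-identityʳ; +-identityʳ; ^-zeroˡ; ≰⇒>; m*n≢0; _!≢0; _!*_!≢0)
  open import Data.Nat.Combinatorics using (_C_; nCk≡n!/k![n-k]!; k>n⇒nCk≡0)
  open import Data.Nat.DivMod using (/-congʳ)
  open import Data.Fin using (Fin; punchIn; punchOut) renaming (zero to fzero; suc to fsuc)
  open import Data.Fin.Properties using (_≟_; punchIn-punchOut; punchInᵢ≢i; any?)
  open import Data.Fin.Subset using (Subset; _∈_)
  open import Data.Fin.Subset.Properties using (_∈?_)
  open import Data.Maybe using (just; nothing)
  open import Data.Maybe.Properties using (just-injective)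
  open import Data.Product using (Σ; ∃; _,_; proj₁; proj₂)
  open import Data.Sum using (_⊎_; inj₁; inj₂)
  open import Relation.Nullary using (¬_; Dec; yes; no)
  open import Relation.Nullary.Negation using (contradiction)
  open import Relation.Binary.PropositionalEquality as ≡ using (_≡_)
  open FiniteSums using (_⪯_; sumTo-cong; sumBelow-cong)
  open WordCounting using (module Words; ≤ᵇ-true; ≤ᵇ-false)
  open ColumnBound using (column-bound)

  multinom-binomial : ∀ r j → multinom r (cons {0} j (λ ())) ≡ r C j
  multinom-binomial r j with j ≤? r
  ... | yes j≤r rewrite ≤ᵇ-true (≡.subst (_≤ r) (≡.sym (+-identityʳ j)) j≤r) =
    ≡.trans (/-congʳ (≡.cong₂ _*_ (*-identityʳ (j !)) (≡.cong (λ x → (r ∸ x) !) (+-identityʳ j))))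
            (≡.sym (nCk≡n!/k![n-k]! j≤r))
    where
    instance
      multinomial-denominator≢0 : NonZero (j ! * 1 * (r ∸ (j + 0)) !)
      multinomial-denominator≢0 = m*n≢0 (j ! * 1) _ {{m*n≢0 (j !) 1 {{j !≢0}}}} {{(r ∸ (j + 0)) !≢0}}
      binomial-denominator≢0 : NonZero (j ! * (r ∸ j) !)
      binomial-denominator≢0 = j !* (r ∸ j) !≢0
  ... | no j≰r rewrite ≤ᵇ-false (j≰r ∘ ≡.subst (_≤ r) (+-identityʳ j)) = ≡.sym (k>n⇒nCk≡0 (≰⇒> j≰r))

  module NonzeroElements {c ℓ : Level} (F : Field c ℓ) {q : ℕ} (card : HasCardinality F (suc q)) where
    open Field F
    private
      e = proj₁ card
      e-injective = proj₁ (proj₂ card)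
      e-surjective = proj₂ (proj₂ card)
      zero-index = proj₁ (e-surjective 0#)

    nonzero : Fin q → Carrier
    nonzero j = e (punchIn zero-index j)

    ZeroOrNonzero : Carrier → Set ℓ
    ZeroOrNonzero x = (x ≈ 0#) ⊎ Σ (Fin q) (λ j → x ≈ nonzero j)

    nonzero≉0 : ∀ j → ¬ (nonzero j ≈ 0#)
    nonzero≉0 j nonzero≈0 =
      punchInᵢ≢i zero-index j (e-injective _ _ (trans nonzero≈0 (proj₂ (e-surjective 0#))))

    classify : ∀ x → ZeroOrNonzero x
    classify x with proj₁ (e-surjective x) ≟ zero-index
    ... | yes i≡z = inj₁ (trans (proj₂ (e-surjective x)) (trans (reflexive (≡.cong e i≡z)) (sym (proj₂ (e-surjective 0#)))))
    ... | no  i≢z = inj₂ (punchOut (i≢z ∘ ≡.sym) ,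
                          trans (proj₂ (e-surjective x)) (reflexive (≡.cong e (≡.sym (punchIn-punchOut _)))))

    -- 1 is nonzero, so there is at least one nonzero element
    one-index : Fin q
    one-index with classify 1#
    ... | inj₁ 1≈0     = contradiction (sym 1≈0) 0≉1
    ... | inj₂ (j , _) = j

  -- ex̄_q(r, k): zero entries form the single class, nonzero entries are free letters.
  -- A field has at least two elements, which disposes of q = 0.
  zeros-bound : ∀ {c ℓ} q (F : Field c ℓ) → HasCardinality F q → ∀ r k m n (M : Matrix F m n) →
    RankAtMost F r M → DistinctColumns F M → (∀ a → HasZeros F k (column F M a)) →
    n ≤ sumTo k (λ i → (r C i) * (q ∸ 1) ^ (r ∸ i))
  zeros-bound zero F (_ , _ , e-surjective) r k m n M rank distinct zeros
    with () ← proj₁ (e-surjective (Field.0# F))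
  zeros-bound (suc q) F card r k m n M rank distinct zeros =
    ≤-trans (column-bound F q (λ _ → 1) one-index value r (λ _ → k) M rank distinct letter
                          (λ a p → decode (classify (M p a))) bounded)
            (≤-reflexive (sumTo-cong k λ j → ≡.cong₂ _*_ (multinom-binomial r j) (weight≡ j)))
    where
    open Field F using (Carrier; _≈_; 0#)
    open NonzeroElements F card
    open Words {1} q (λ _ → 1)

    encode : ∀ {x} → ZeroOrNonzero x → Letter
    encode (inj₁ _)       = just fzero , fzero
    encode (inj₂ (j , _)) = nothing , j

    value : Letter → Carrier
    value (nothing , j) = nonzero j
    value (just _  , _) = 0#

    decode : ∀ {x} (d : ZeroOrNonzero x) → x ≈ value (encode d)
    decode (inj₁ x≈0)       = x≈0
    decode (inj₂ (_ , x≈y)) = x≈y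

    encodes-zero : ∀ {x} (d : ZeroOrNonzero x) → class (encode d) ≡ just fzero → x ≈ 0#
    encodes-zero (inj₁ x≈0) _ = x≈0

    letter : Fin n → Fin m → Letter
    letter a p = encode (classify (M p a))

    Z : Fin n → Subset m
    Z a = proj₁ (zeros a)

    zero-positions : ∀ a p → class (letter a p) ≡ just fzero → p ∈ Z a
    zero-positions a p zero-letter with p ∈? Z a
    ... | yes p∈Z = p∈Z
    ... | no  p∉Z = contradiction (encodes-zero (classify (M p a)) zero-letter) (proj₂ (proj₂ (proj₂ (zeros a))) p p∉Z)

    bounded : ∀ a → profile (letter a) ⪯ (λ _ → k)
    bounded a fzero = ≤-trans (profile-bound (letter a) fzero (Z a) (zero-positions a))
                              (≤-reflexive (proj₁ (proj₂ (zeros a))))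
    bounded a (fsuc ())

    weight≡ : ∀ j → (1 ^ j * 1) * q ^ (r ∸ (j + 0)) ≡ q ^ (r ∸ j)
    weight≡ j = ≡.trans (≡.cong₂ _*_ (≡.trans (*-identityʳ _) (^-zeroˡ j))
                                     (≡.cong (λ x → q ^ (r ∸ x)) (+-identityʳ j)))
                        (*-identityˡ _)

  -- ex_q(r, k): nonzero entries form the single class, 0 is the free letter.
  weights-bound : ∀ {c ℓ} q (F : Field c ℓ) → HasCardinality F q → ∀ r k m n (M : Matrix F m n) →
    RankAtMost F r M → DistinctColumns F M → (∀ a → HasWeight F k (column F M a)) →
    n ≤ sumTo k (λ i → (r C i) * (q ∸ 1) ^ i)
  weights-bound zero F (_ , _ , e-surjective) r k m n M rank distinct weights
    with () ← proj₁ (e-surjective (Field.0# F))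
  weights-bound (suc q) F card r k m n M rank distinct weights =
    ≤-trans (column-bound F 1 (λ _ → q) fzero value r (λ _ → k) M rank distinct letter
                          (λ a p → decode (classify (M p a))) bounded)
            (≤-reflexive (sumTo-cong k λ j → ≡.cong₂ _*_ (multinom-binomial r j) (weight≡ j)))
    where
    open Field F using (Carrier; _≈_; 0#; trans; sym)
    open NonzeroElements F card
    open Words {1} 1 (λ _ → q)

    encode : ∀ {x} → ZeroOrNonzero x → Letter
    encode (inj₁ _)       = nothing , fzero
    encode (inj₂ (j , _)) = just fzero , j

    value : Letter → Carrier
    value (nothing , _) = 0#
    value (just _  , j) = nonzero j

    decode : ∀ {x} (d : ZeroOrNonzero x) → x ≈ value (encode d)
    decode (inj₁ x≈0)       = x≈0
    decode (inj₂ (_ , x≈y)) = x≈y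

    encodes-nonzero : ∀ {x} (d : ZeroOrNonzero x) → class (encode d) ≡ just fzero → ¬ (x ≈ 0#)
    encodes-nonzero (inj₂ (j , x≈y)) _ x≈0 = nonzero≉0 j (trans (sym x≈y) x≈0)

    letter : Fin n → Fin m → Letter
    letter a p = encode (classify (M p a))

    Supp : Fin n → Subset m
    Supp a = proj₁ (weights a)

    support-positions : ∀ a p → class (letter a p) ≡ just fzero → p ∈ Supp a
    support-positions a p nonzero-letter with p ∈? Supp a
    ... | yes p∈S = p∈S
    ... | no  p∉S = contradiction (proj₂ (proj₂ (proj₂ (weights a))) p p∉S) (encodes-nonzero (classify (M p a)) nonzero-letter)

    bounded : ∀ a → profile (letter a) ⪯ (λ _ → k)
    bounded a fzero = ≤-trans (profile-bound (letter a) fzero (Supp a) (support-positions a))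
                              (≤-reflexive (proj₁ (proj₂ (weights a))))
    bounded a (fsuc ())

    weight≡ : ∀ j → (q ^ j * 1) * 1 ^ (r ∸ (j + 0)) ≡ q ^ j
    weight≡ j = ≡.trans (≡.cong₂ _*_ (*-identityʳ (q ^ j)) (^-zeroˡ (r ∸ (j + 0)))) (*-identityʳ (q ^ j))

  -- ex_{F,𝓛}(r, κ): entries in Lᵢ form class i, and 0 is the free letter.
  sets-bound : ∀ {c ℓ} (F : Field c ℓ) (r s : ℕ) (L : Fin s → FinSubsetNZ F) → PairwiseDisjoint F L →
    (κ : Fin s → ℕ) (m n : ℕ) (M : Matrix F m n) → RankAtMost F r M → DistinctColumns F M →
    (∀ a → IsLκVector F L κ (column F M a)) →
    n ≤ sumBelow κ (λ κ' → multinom r κ' * Lpow F L κ')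
  sets-bound F r s L _ κ m n M rank distinct vectors =
    ≤-trans (column-bound F 1 (λ i → size (L i)) fzero value r κ M rank distinct letter
                          (λ a p → decode a p (any? (λ i → p ∈? S a i))) bounded)
            (≤-reflexive (sumBelow-cong κ λ κ' → ≡.cong (multinom r κ' *_)
              (≡.trans (≡.cong (Lpow F L κ' *_) (^-zeroˡ (r ∸ sumFin κ'))) (*-identityʳ _))))
    where
    open Field F using (Carrier; _≈_; 0#)
    open Words 1 (λ i → size (L i))

    S : Fin n → Fin s → Subset m
    S a = proj₁ (vectors a)

    encode : ∀ a p → Dec (∃ λ i → p ∈ S a i) → Letter
    encode a p (yes (i , p∈Sᵢ)) = just i , proj₁ (proj₁ (proj₂ (proj₂ (vectors a))) i p p∈Sᵢ)
    encode a p (no  _)          = nothing , fzero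

    value : Letter → Carrier
    value (nothing , _) = 0#
    value (just i  , j) = elem (L i) j

    decode : ∀ a p d → M p a ≈ value (encode a p d)
    decode a p (yes (i , p∈Sᵢ)) = proj₂ (proj₁ (proj₂ (proj₂ (vectors a))) i p p∈Sᵢ)
    decode a p (no  p∉S)        = proj₂ (proj₂ (proj₂ (proj₂ (vectors a)))) p (λ i p∈Sᵢ → p∉S (i , p∈Sᵢ))

    letter : Fin n → Fin m → Letter
    letter a p = encode a p (any? (λ i → p ∈? S a i))

    class-positions : ∀ a i p → class (letter a p) ≡ just i → p ∈ S a i
    class-positions a i p = positions (any? (λ i → p ∈? S a i))
      where
      positions : ∀ d → class (encode a p d) ≡ just i → p ∈ S a i
      positions (yes (i' , p∈Sᵢ')) i'≡i = ≡.subst (λ x → p ∈ S a x) (just-injective i'≡i) p∈Sᵢ'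

    bounded : ∀ a → profile (letter a) ⪯ κ
    bounded a i = ≤-trans (profile-bound (letter a) i (S a i) (λ p → class-positions a i p))
                          (≤-reflexive (proj₁ (proj₂ (vectors a)) i))

open import Level using (Level)
open import Data.Nat using (ℕ; _≤_; _*_; _^_; _∸_)
open import Data.Nat.Combinatorics using (_C_)
open import Data.Fin using (Fin)
open import Data.Product using (_×_; _,_)
open Applications using (zeros-bound; sets-bound; weights-bound)

corollary1 : {c ℓ : Level} →
    -- (1)  ex̄_q(r,k) ≤ ∑_{i=0}^k C(r,i) (q-1)^(r-i)
    ((q : ℕ) (F : Field c ℓ) → HasCardinality F q →
      (r k m n : ℕ) (M : Matrix F m n) →
      RankAtMost F r M → DistinctColumns F M →
      (∀ a → HasZeros F k (column F M a)) →
      n ≤ sumTo k (λ i → (r C i) * (q ∸ 1) ^ (r ∸ i)))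
    ×
    -- (2)  ex_{F,𝓛}(r,κ) ≤ ∑_{κ' ⪯ κ} C(r;κ') 𝓛^κ'
    ((F : Field c ℓ) (r s : ℕ) (L : Fin s → FinSubsetNZ F) →
      PairwiseDisjoint F L → (κ : Fin s → ℕ) →
      (m n : ℕ) (M : Matrix F m n) →
      RankAtMost F r M → DistinctColumns F M →
      (∀ a → IsLκVector F L κ (column F M a)) →
      n ≤ sumBelow κ (λ κ' → multinom r κ' * Lpow F L κ'))
    ×
    -- (3)  ex_q(r,k) ≤ ∑_{i=0}^k C(r,i) (q-1)^i
    ((q : ℕ) (F : Field c ℓ) → HasCardinality F q →
      (r k m n : ℕ) (M : Matrix F m n) →
      RankAtMost F r M → DistinctColumns F M →
      (∀ a → HasWeight F k (column F M a)) →
      n ≤ sumTo k (λ i → (r C i) * (q ∸ 1) ^ i))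
corollary1 = zeros-bound , sets-bound , weights-bound
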